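{- Let $k\ge1$, $m\ge3$ and $n\ge4$ be integers. Then \[ \gamma_{[k]R}(C_m\Box P_n) \le m (n-2)\left\lceil\frac{k+4}{5}\right\rceil + 2m\left\lceil \frac{k+3-\left\lceil\frac{k+4}{5}\right\rceil}{3} \right\rceil. \]
   Context: All graphs are finite and simple. For a vertex $v$ of a graph $G$, $N(v)$ denotes its open neighborhood and $N[v]=N(v)\cup\{v\}$ its closed neighborhood. For $f:V(G)\to\mathbb{N}_0$ and $S\subseteq V(G)$ write $f(S)=\sum_{u\in S}f(u)$. For a positive integer $k$, a $[k]$-Roman dominating function of $G$ is a function $f:V(G)\to\{0,1,\dots,k+1\}$ such that every vertex $v$ with $f(v)<k$ satisfies $f(N[v])\ge k+|AN(v)|$, where $AN(v)=\{u\in N(v): f(u)>0\}$. The $[k]$-Roman domination number $\gamma_{[k]R}(G)$ is the minimum of $f(V(G))$ over all $[k]$-Roman dominating functions $f$ of $G$. $C_m\Box P_n$ denotes the Cartesian product of the cycle $C_m$ ($m\ge3$) and the path $P_n$ on $n$ vertices: its vertices are pairs $(i,j)$ with $i\in\{0,\dots,m-1\}$, $j\in\{0,\dots,n-1\}$, and $(i,j)$ is adjacent to $(i',j')$ iff either $j=j'$ and $i-i'\equiv\pm1\pmod m$, or $i=i'$ and $|j-j'|=1$. -}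

module Defs where

open import Data.Nat using (ℕ; zero; suc; _+_; _*_; _∸_; _≤_; _<_; _≡ᵇ_; NonZero)
open import Data.Nat.DivMod using (_/_; _%_)
open import Data.Fin using (Fin; toℕ)
open import Data.Bool using (Bool; true; false; _∧_; _∨_; if_then_else_)
open import Data.List using (List; map; concatMap; allFin; length; filter)
open import Data.Nat.ListAction using (sum)
open import Data.Product using (_×_; _,_)

⌈_/_⌉ : ℕ → (b : ℕ) → .{{NonZero b}} → ℕ
⌈ a / b ⌉ = (a + b ∸ 1) / b

Vertex : ℕ → ℕ → Set
Vertex m n = Fin m × Fin n

cycAdj : (m : ℕ) → Fin m → Fin m → Bool
cycAdj m i i' = (toℕ i' ≡ᵇ suc (toℕ i)) ∨ (toℕ i ≡ᵇ suc (toℕ i'))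
  ∨ ((toℕ i ≡ᵇ 0) ∧ (toℕ i' ≡ᵇ m ∸ 1)) ∨ ((toℕ i' ≡ᵇ 0) ∧ (toℕ i ≡ᵇ m ∸ 1))

pathAdj : {n : ℕ} → Fin n → Fin n → Bool
pathAdj j j' = (toℕ j' ≡ᵇ suc (toℕ j)) ∨ (toℕ j ≡ᵇ suc (toℕ j'))

adj : (m n : ℕ) → Vertex m n → Vertex m n → Bool
adj m n (i , j) (i' , j') =
  ((toℕ j ≡ᵇ toℕ j') ∧ cycAdj m i i') ∨ ((toℕ i ≡ᵇ toℕ i') ∧ pathAdj j j')

vertices : (m n : ℕ) → List (Vertex m n)
vertices m n = concatMap (λ i → map (λ j → (i , j)) (allFin n)) (allFin m)

N : (m n : ℕ) → Vertex m n → List (Vertex m n)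
N m n v = filter (λ u → adj m n v u Data.Bool.≟ true) (vertices m n)

weightOn : {m n : ℕ} → (Vertex m n → ℕ) → List (Vertex m n) → ℕ
weightOn f S = sum (map f S)

weight : (m n : ℕ) → (Vertex m n → ℕ) → ℕ
weight m n f = weightOn f (vertices m n)

closedNbhdWeight : (m n : ℕ) → (Vertex m n → ℕ) → Vertex m n → ℕ
closedNbhdWeight m n f v = f v + weightOn f (N m n v)

activeNbrs : (m n : ℕ) → (Vertex m n → ℕ) → Vertex m n → ℕ
activeNbrs m n f v = length (filter (λ u → 0 Data.Nat.<? f u) (N m n v))

record IsKRDF (k m n : ℕ) (f : Vertex m n → ℕ) : Set where
  field
    range : ∀ v → f v ≤ k + 1
    condition : ∀ v → f v < k → k + activeNbrs m n f v ≤ closedNbhdWeight m n f v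

{-# OPTIONS --safe #-}
module Submission where

-- Give the vertices of the two end copies C_m × {0} and C_m × {n−1} the value
-- B = ⌈(k+3−A)/3⌉ and all other vertices the value A = ⌈(k+4)/5⌉. Every vertex
-- is then active, so the condition at v reads f(N[v]) ≥ k + deg v, that is
-- 5A ≥ k+4 away from the ends, 4A+B ≥ k+4 next to an end and 3B+A ≥ k+3 on an
-- end copy. The first and last hold by the choice of A and B, the middle one
-- follows from 3(4A+B) = 2·5A + (3B+A) + A, and k ≥ 1 gives A, B ≤ k+1.
-- The weight of f is m(n−2)A + 2mB.

open import Defs
open import Data.Nat using (ℕ; zero; suc; _+_; _*_; _∸_; _≤_; _<_; _<?_; _≡ᵇ_; z≤n; s≤s; s≤s⁻¹; z<s; s<s; NonZero)
open import Data.Nat.Properties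
open import Data.Nat.Tactic.RingSolver using (solve)
open import Algebra.Properties.CommutativeSemigroup +-commutativeSemigroup
  using (x∙yz≈y∙xz; xy∙z≈x∙zy) renaming (interchange to +-interchange)
open import Data.Nat.DivMod using (_/_; _%_; m≡m%n+[m/n]*n; m%n<n; m/n*n≤m)
open import Data.Nat.ListAction using (sum)
open import Data.Nat.ListAction.Properties using (sum-++)
open import Data.Bool using (Bool; true; false; T; _∧_; _∨_; if_then_else_)
open import Data.Bool.Properties using (T-∨; T-∧)
import Data.Fin as Fin
open Fin using (Fin; toℕ)
open import Data.Fin.Properties using (toℕ<n)
open import Data.List using (List; []; _∷_; _++_; map; concatMap; filter; length; tabulate; allFin)
open import Data.List.Properties using (map-++; map-tabulate; filter-all)
import Data.List.Relation.Unary.All as All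
open import Data.Product using (Σ; _×_; _,_; proj₁; proj₂; map₂)
open import Data.Sum using (inj₁; inj₂)
open import Function using (_∘_)
open import Function.Bundles using (Equivalence)
open import Relation.Nullary using (¬_; yes; no; does; contradiction)
open import Relation.Nullary.Decidable using (dec-true; dec-false)
open import Relation.Binary.PropositionalEquality

m≤⌈m/n⌉*n : ∀ m n .{{_ : NonZero n}} → m ≤ ⌈ m / n ⌉ * n
m≤⌈m/n⌉*n m n@(suc d) = +-cancelʳ-≤ d m _ (begin
  m + d             ≡⟨ +-∸-assoc m (s≤s z≤n) ⟨
  q                 ≡⟨ m≡m%n+[m/n]*n q n ⟩
  q % n + q / n * n ≤⟨ +-monoˡ-≤ _ (s≤s⁻¹ (m%n<n q n)) ⟩
  d + q / n * n     ≡⟨ +-comm d _ ⟩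
  q / n * n + d     ∎)
  where
  open ≤-Reasoning
  q = m + n ∸ 1

⌈m/n⌉*n<m+n : ∀ m n .{{_ : NonZero n}} → ⌈ m / n ⌉ * n < m + n
⌈m/n⌉*n<m+n m n@(suc d) = begin-strict
  (m + n ∸ 1) / n * n ≤⟨ m/n*n≤m (m + n ∸ 1) n ⟩
  m + n ∸ 1           ≡⟨ +-∸-assoc m (s≤s z≤n) ⟩
  m + d               <⟨ +-monoʳ-< m (n<1+n d) ⟩
  m + n               ∎
  where open ≤-Reasoning

∑< : ℕ → (ℕ → ℕ) → ℕ
∑< zero    h = 0
∑< (suc n) h = h 0 + ∑< n (h ∘ suc)

infix 5 ∑<
syntax ∑< n (λ t → e) = ∑[ t < n ] e

∑-cong : ∀ n {h h′ : ℕ → ℕ} → (∀ t → h t ≡ h′ t) → ∑< n h ≡ ∑< n h′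
∑-cong zero    eq = refl
∑-cong (suc n) eq = cong₂ _+_ (eq 0) (∑-cong n (eq ∘ suc))

∑-mono-≤ : ∀ n {h h′ : ℕ → ℕ} → (∀ t → h t ≤ h′ t) → ∑< n h ≤ ∑< n h′
∑-mono-≤ zero    le = z≤n
∑-mono-≤ (suc n) le = +-mono-≤ (le 0) (∑-mono-≤ n (le ∘ suc))

∑-distrib-+ : ∀ n (h h′ : ℕ → ℕ) → ∑[ t < n ] (h t + h′ t) ≡ ∑< n h + ∑< n h′
∑-distrib-+ zero    h h′ = refl
∑-distrib-+ (suc n) h h′ = begin
  h 0 + h′ 0 + (∑[ t < n ] h (suc t) + h′ (suc t)) ≡⟨ cong (h 0 + h′ 0 +_) (∑-distrib-+ n (h ∘ suc) (h′ ∘ suc)) ⟩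
  h 0 + h′ 0 + (S + S′)                            ≡⟨ +-interchange (h 0) (h′ 0) S S′ ⟩
  h 0 + S + (h′ 0 + S′)                            ∎
  where
  open ≡-Reasoning
  S  = ∑< n (h ∘ suc)
  S′ = ∑< n (h′ ∘ suc)

∑-const : ∀ n c → ∑[ t < n ] c ≡ n * c
∑-const zero    c = refl
∑-const (suc n) c = cong (c +_) (∑-const n c)

∑-const-< : ∀ n {h : ℕ → ℕ} {c} → (∀ t → t < n → h t ≡ c) → ∑< n h ≡ n * c
∑-const-< zero    eq = refl
∑-const-< (suc n) eq = cong₂ _+_ (eq 0 z<s) (∑-const-< n (λ t t<n → eq (suc t) (s<s t<n)))

∑-last : ∀ n (h : ℕ → ℕ) → ∑< (suc n) h ≡ ∑< n h + h n
∑-last zero    h = +-comm (h 0) 0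
∑-last (suc n) h = trans (cong (h 0 +_) (∑-last n (h ∘ suc))) (sym (+-assoc (h 0) _ _))

term≤∑ : ∀ n (h : ℕ → ℕ) {t} → t < n → h t ≤ ∑< n h
term≤∑ (suc n) h {zero}  _         = m≤m+n (h 0) _
term≤∑ (suc n) h {suc t} (s<s t<n) = ≤-trans (term≤∑ n (h ∘ suc) t<n) (m≤n+m _ (h 0))

two-terms≤∑ : ∀ n (h : ℕ → ℕ) {s t} → s < n → t < n → s ≢ t → h s + h t ≤ ∑< n h
two-terms≤∑ (suc n) h {zero}  {zero}  _         _         s≢t = contradiction refl s≢t
two-terms≤∑ (suc n) h {zero}  {suc t} _         (s<s t<n) _   = +-monoʳ-≤ (h 0) (term≤∑ n (h ∘ suc) t<n)
two-terms≤∑ (suc n) h {suc s} {zero}  (s<s s<n) _         _   = begin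
  h (suc s) + h 0      ≡⟨ +-comm (h (suc s)) (h 0) ⟩
  h 0 + h (suc s)      ≤⟨ +-monoʳ-≤ (h 0) (term≤∑ n (h ∘ suc) s<n) ⟩
  ∑< (suc n) h         ∎
  where open ≤-Reasoning
two-terms≤∑ (suc n) h {suc s} {suc t} (s<s s<n) (s<s t<n) s≢t =
  ≤-trans (two-terms≤∑ n (h ∘ suc) s<n t<n (s≢t ∘ cong suc)) (m≤n+m _ (h 0))

module _ {A : Set} where

  sum-map-concatMap : ∀ {B : Set} (f : A → ℕ) (R : B → List A) xs →
    sum (map f (concatMap R xs)) ≡ sum (map (λ x → sum (map f (R x))) xs)
  sum-map-concatMap f R []       = refl
  sum-map-concatMap f R (x ∷ xs) = begin
    sum (map f (R x ++ concatMap R xs))           ≡⟨ cong sum (map-++ f (R x) _) ⟩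
    sum (map f (R x) ++ map f (concatMap R xs))   ≡⟨ sum-++ (map f (R x)) _ ⟩
    sum (map f (R x)) + sum (map f (concatMap R xs))        ≡⟨ cong (sum (map f (R x)) +_) (sum-map-concatMap f R xs) ⟩
    sum (map f (R x)) + sum (map (λ y → sum (map f (R y))) xs) ∎
    where open ≡-Reasoning

  sum-map-tabulate : ∀ {n} (g : Fin n → A) (f : A → ℕ) {h : ℕ → ℕ} →
    (∀ i → f (g i) ≡ h (toℕ i)) → sum (map f (tabulate g)) ≡ ∑< n h
  sum-map-tabulate {zero}  g f eq = refl
  sum-map-tabulate {suc n} g f eq = cong₂ _+_ (eq Fin.zero) (sum-map-tabulate (g ∘ Fin.suc) f (eq ∘ Fin.suc))

  sum-map-filter : ∀ (p : A → Bool) (f : A → ℕ) xs →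
    sum (map f (filter (λ x → p x Data.Bool.≟ true) xs)) ≡ sum (map (λ x → if p x then f x else 0) xs)
  sum-map-filter p f []       = refl
  sum-map-filter p f (x ∷ xs) with p x
  ... | true  = cong (f x +_) (sum-map-filter p f xs)
  ... | false = sum-map-filter p f xs

  sum-map-suc : ∀ (g : A → ℕ) xs → sum (map (suc ∘ g) xs) ≡ length xs + sum (map g xs)
  sum-map-suc g []       = refl
  sum-map-suc g (x ∷ xs) = cong suc (begin
    g x + sum (map (suc ∘ g) xs)     ≡⟨ cong (g x +_) (sum-map-suc g xs) ⟩
    g x + (length xs + sum (map g xs)) ≡⟨ x∙yz≈y∙xz (g x) (length xs) _ ⟩
    length xs + (g x + sum (map g xs)) ∎)
    where open ≡-Reasoning

sum-vertices : ∀ m n (H : ℕ → ℕ → ℕ) →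
  sum (map (λ v → H (toℕ (proj₁ v)) (toℕ (proj₂ v))) (vertices m n)) ≡ (∑[ s < m ] ∑[ t < n ] H s t)
sum-vertices m n H = begin
  sum (map φ (concatMap layer (allFin m)))               ≡⟨ sum-map-concatMap φ layer (allFin m) ⟩
  sum (map (λ i → sum (map φ (layer i))) (allFin m))     ≡⟨ sum-map-tabulate (λ i → i) _ layer-sum ⟩
  (∑[ s < m ] ∑[ t < n ] H s t)                          ∎
  where
  open ≡-Reasoning
  φ : Vertex m n → ℕ
  φ v = H (toℕ (proj₁ v)) (toℕ (proj₂ v))
  layer : Fin m → List (Vertex m n)
  layer i = map (i ,_) (allFin n)
  layer-sum : ∀ i → sum (map φ (layer i)) ≡ (∑[ t < n ] H (toℕ i) t)
  layer-sum i = trans (cong (sum ∘ map φ) (map-tabulate (λ j → j) (i ,_))) (sum-map-tabulate (i ,_) φ (λ _ → refl))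

-- With f = 1 + g every neighbour is active, so |AN(v)| cancels against the
-- ones that f contributes on N(v), leaving the condition k ≤ 1 + g(N[v]).
isKRDF-suc : ∀ {k m n} (g : Vertex m n → ℕ) → (∀ v → g v ≤ k) →
  (∀ v → k ≤ suc (g v + weightOn g (N m n v))) → IsKRDF k m n (suc ∘ g)
isKRDF-suc {k} {m} {n} g g≤k closed = record
  { range     = λ v → ≤-trans (s≤s (g≤k v)) (≤-reflexive (+-comm 1 k))
  ; condition = λ v _ → condition v
  }
  where
  condition : ∀ v → k + activeNbrs m n (suc ∘ g) v ≤ closedNbhdWeight m n (suc ∘ g) v
  condition v = begin
    k + length (filter (λ u → 0 <? suc (g u)) L) ≡⟨ cong (λ xs → k + length xs) all-active ⟩
    k + length L                                 ≤⟨ +-monoˡ-≤ (length L) (closed v) ⟩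
    suc (g v + weightOn g L) + length L          ≡⟨ cong suc (xy∙z≈x∙zy (g v) (weightOn g L) (length L)) ⟩
    suc (g v) + (length L + weightOn g L)        ≡⟨ cong (suc (g v) +_) (sum-map-suc g L) ⟨
    closedNbhdWeight m n (suc ∘ g) v             ∎
    where
    open ≤-Reasoning
    L = N m n v
    all-active : filter (λ u → 0 <? suc (g u)) L ≡ L
    all-active = filter-all (λ u → 0 <? suc (g u)) (All.universal (λ _ → z<s) L)

cycAdjℕ : ℕ → ℕ → ℕ → Bool
cycAdjℕ m s t = (t ≡ᵇ suc s) ∨ (s ≡ᵇ suc t) ∨ ((s ≡ᵇ 0) ∧ (t ≡ᵇ m ∸ 1)) ∨ ((t ≡ᵇ 0) ∧ (s ≡ᵇ m ∸ 1))

pathAdjℕ : ℕ → ℕ → Bool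
pathAdjℕ s t = (t ≡ᵇ suc s) ∨ (s ≡ᵇ suc t)

private
  ∨-introˡ : ∀ {x} y → T x → T (x ∨ y)
  ∨-introˡ y p = Equivalence.from T-∨ (inj₁ p)

  ∨-introʳ : ∀ x {y} → T y → T (x ∨ y)
  ∨-introʳ x p = Equivalence.from T-∨ (inj₂ p)

  ≡ᵇ-refl : ∀ t → T (t ≡ᵇ t)
  ≡ᵇ-refl t = ≡⇒≡ᵇ t t refl

  ≡ᵇ-suc : ∀ t → ¬ T (t ≡ᵇ suc t)
  ≡ᵇ-suc t = <⇒≢ (n<1+n t) ∘ ≡ᵇ⇒≡ t (suc t)

cycAdjℕ-suc : ∀ m s → T (cycAdjℕ m s (suc s))
cycAdjℕ-suc m s = ∨-introˡ _ (≡ᵇ-refl s)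

cycAdjℕ-pred : ∀ m t → T (cycAdjℕ m (suc t) t)
cycAdjℕ-pred m t = ∨-introʳ (t ≡ᵇ suc (suc t)) (∨-introˡ _ (≡ᵇ-refl t))

cycAdjℕ-first-last : ∀ m → T (cycAdjℕ m 0 (m ∸ 1))
cycAdjℕ-first-last m = ∨-introʳ (m ∸ 1 ≡ᵇ 1) (∨-introʳ (0 ≡ᵇ suc (m ∸ 1)) (∨-introˡ _ (≡ᵇ-refl (m ∸ 1))))

cycAdjℕ-last-first : ∀ m → T (cycAdjℕ (suc m) m 0)
cycAdjℕ-last-first m = ∨-introʳ (0 ≡ᵇ suc m) (∨-introʳ (m ≡ᵇ 1) (∨-introʳ ((m ≡ᵇ 0) ∧ (0 ≡ᵇ m)) (≡ᵇ-refl m)))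

cycAdjℕ-irrefl : ∀ {m} → 2 ≤ m → ∀ t → ¬ T (cycAdjℕ m t t)
cycAdjℕ-irrefl {suc zero} (s≤s ())
cycAdjℕ-irrefl {suc (suc m)} _ zero    ()
cycAdjℕ-irrefl {suc (suc m)} _ (suc t) adj with Equivalence.to T-∨ adj
... | inj₁ p = ≡ᵇ-suc t p
... | inj₂ q with Equivalence.to T-∨ q
...   | inj₁ p = ≡ᵇ-suc t p
...   | inj₂ ()

if-true : ∀ {b} (c : ℕ) → T b → (if b then c else 0) ≡ c
if-true {true} c _ = refl

if-∨-≥ : ∀ x y c → ¬ (T x × T y) → (if x then c else 0) + (if y then c else 0) ≤ (if x ∨ y then c else 0)
if-∨-≥ false y     c _        = ≤-refl
if-∨-≥ true  false c _        = ≤-reflexive (+-identityʳ c)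
if-∨-≥ true  true  c disjoint = contradiction (_ , _) disjoint

≡ᵇ-refl-∧ : ∀ t x → ((t ≡ᵇ t) ∧ x) ≡ x
≡ᵇ-refl-∧ zero    x = refl
≡ᵇ-refl-∧ (suc t) x = ≡ᵇ-refl-∧ t x

module _ (n : ℕ) (p : ℕ → Bool) (h : ℕ → ℕ) where

  private
    selected : ℕ → ℕ
    selected t = if p t then h t else 0

  selected-term≤∑ : ∀ {s} → s < n → T (p s) → h s ≤ (∑[ t < n ] (if p t then h t else 0))
  selected-term≤∑ s<n ps = subst (_≤ ∑< n selected) (if-true _ ps) (term≤∑ n selected s<n)

  selected-terms≤∑ : ∀ {s s′} → s < n → s′ < n → s ≢ s′ → T (p s) → T (p s′) →
    h s + h s′ ≤ (∑[ t < n ] (if p t then h t else 0))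
  selected-terms≤∑ s<n s′<n s≢s′ ps ps′ =
    subst (_≤ ∑< n selected) (cong₂ _+_ (if-true _ ps) (if-true _ ps′))
      (two-terms≤∑ n selected s<n s′<n s≢s′)

cycle-degree : ∀ {m t} → 3 ≤ m → t < m → ∀ c → c + c ≤ (∑[ s < m ] (if cycAdjℕ m t s then c else 0))
cycle-degree {suc zero}       (s≤s ())
cycle-degree {suc (suc zero)} (s≤s (s≤s ()))
cycle-degree {M@(suc (suc (suc m)))} {zero} _ _ c =
  selected-terms≤∑ M (cycAdjℕ M 0) (λ _ → c) (s<s z<s) ≤-refl (λ ()) (cycAdjℕ-suc M 0) (cycAdjℕ-first-last M)
cycle-degree {M@(suc (suc (suc m)))} {suc t} _ 1+t<M c with suc (suc t) <? M
... | yes 2+t<M = selected-terms≤∑ M (cycAdjℕ M (suc t)) (λ _ → c) (<-trans (n<1+n t) 1+t<M) 2+t<M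
                    (<⇒≢ (<-trans (n<1+n t) (n<1+n (suc t)))) (cycAdjℕ-pred M t) (cycAdjℕ-suc M (suc t))
... | no  2+t≮M = selected-terms≤∑ M (cycAdjℕ M (suc t)) (λ _ → c) (<-trans (n<1+n t) 1+t<M) z<s
                    t≢0 (cycAdjℕ-pred M t)
                    (subst (λ s → T (cycAdjℕ M s 0)) (sym 1+t≡M-1) (cycAdjℕ-last-first (suc (suc m))))
  where
  1+t≡M-1 : suc t ≡ suc (suc m)
  1+t≡M-1 = suc-injective (≤-antisym 1+t<M (≮⇒≥ 2+t≮M))
  t≢0 : t ≢ 0
  t≢0 refl = 0≢1+n (suc-injective 1+t≡M-1)

pathNbrSum : ℕ → (ℕ → ℕ) → ℕ → ℕ
pathNbrSum n G t = ∑[ s < n ] (if pathAdjℕ t s then G s else 0)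

pathNbrSum-≥-suc : ∀ n G t → suc t < n → G (suc t) ≤ pathNbrSum n G t
pathNbrSum-≥-suc n G t 1+t<n = selected-term≤∑ n (pathAdjℕ t) G 1+t<n (∨-introˡ _ (≡ᵇ-refl t))

pathNbrSum-≥-pred : ∀ n G t → t < n → G t ≤ pathNbrSum n G (suc t)
pathNbrSum-≥-pred n G t t<n = selected-term≤∑ n (pathAdjℕ (suc t)) G t<n (∨-introʳ _ (≡ᵇ-refl t))

pathNbrSum-≥-both : ∀ n G t → suc (suc t) < n → G t + G (suc (suc t)) ≤ pathNbrSum n G (suc t)
pathNbrSum-≥-both n G t 2+t<n = selected-terms≤∑ n (pathAdjℕ (suc t)) G
  (<-trans (<-trans (n<1+n t) (n<1+n (suc t))) 2+t<n) 2+t<n (<⇒≢ (<-trans (n<1+n t) (n<1+n (suc t))))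
  (∨-introʳ _ (≡ᵇ-refl t)) (∨-introˡ _ (≡ᵇ-refl (suc t)))

layerwise : ∀ {m n} → (ℕ → ℕ) → Vertex m n → ℕ
layerwise G v = G (toℕ (proj₂ v))

layerwise-weightOn-N≥ : ∀ {m n} → 3 ≤ m → ∀ (G : ℕ → ℕ) i j →
  G (toℕ j) + G (toℕ j) + pathNbrSum n G (toℕ j) ≤ weightOn (layerwise G) (N m n (i , j))
layerwise-weightOn-N≥ {m} {n} 3≤m G i j = begin
  G tj + G tj + pathNbrSum n G tj
    ≤⟨ +-mono-≤ cycle-part path-part ⟩
  (∑[ s < m ] ∑[ t < n ] along-cycle s t) + (∑[ s < m ] ∑[ t < n ] along-path s t)
    ≡⟨ trans (∑-cong m (λ s → ∑-distrib-+ n _ _)) (∑-distrib-+ m _ _) ⟨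
  (∑[ s < m ] ∑[ t < n ] (along-cycle s t + along-path s t))
    ≤⟨ ∑-mono-≤ m (λ s → ∑-mono-≤ n (λ t → if-∨-≥ _ _ (G t) (disjoint s t))) ⟩
  (∑[ s < m ] ∑[ t < n ] (if ((tj ≡ᵇ t) ∧ cycAdjℕ m ti s) ∨ ((ti ≡ᵇ s) ∧ pathAdjℕ tj t) then G t else 0))
    ≡⟨ sum-vertices m n _ ⟨
  sum (map (λ u → if adj m n (i , j) u then layerwise G u else 0) (vertices m n))
    ≡⟨ sum-map-filter (adj m n (i , j)) (layerwise G) (vertices m n) ⟨
  weightOn (layerwise G) (N m n (i , j)) ∎
  where
  open ≤-Reasoning
  ti = toℕ i
  tj = toℕ j
  along-cycle along-path : ℕ → ℕ → ℕ
  along-cycle s t = if (tj ≡ᵇ t) ∧ cycAdjℕ m ti s then G t else 0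
  along-path  s t = if (ti ≡ᵇ s) ∧ pathAdjℕ tj t then G t else 0

  cycle-part : G tj + G tj ≤ (∑[ s < m ] ∑[ t < n ] along-cycle s t)
  cycle-part = ≤-trans (cycle-degree 3≤m (toℕ<n i) (G tj)) (∑-mono-≤ m λ s →
    subst (_≤ ∑< n (along-cycle s)) (cong (λ b → if b then G tj else 0) (≡ᵇ-refl-∧ tj _)) (term≤∑ n (along-cycle s) (toℕ<n j)))

  path-part : pathNbrSum n G tj ≤ (∑[ s < m ] ∑[ t < n ] along-path s t)
  path-part = subst (_≤ ∑[ s < m ] ∑< n (along-path s)) (∑-cong n (λ t → cong (λ b → if b then G t else 0) (≡ᵇ-refl-∧ ti _)))
    (term≤∑ m (λ s → ∑[ t < n ] along-path s t) (toℕ<n i))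

  disjoint : ∀ s t → ¬ (T ((tj ≡ᵇ t) ∧ cycAdjℕ m ti s) × T ((ti ≡ᵇ s) ∧ pathAdjℕ tj t))
  disjoint s t (on-cycle , on-path) = cycAdjℕ-irrefl (<⇒≤ 3≤m) ti
    (subst (λ s → T (cycAdjℕ m ti s)) (sym (≡ᵇ⇒≡ ti s (proj₁ (Equivalence.to T-∧ on-path))))
      (proj₂ (Equivalence.to T-∧ on-cycle)))

profile : ℕ → ℕ → ℕ → ℕ → ℕ
profile n a b zero    = b
profile n a b (suc t) = if does (suc (suc t) ≟ n) then b else a

module _ {n a b : ℕ} where

  profile-inner : ∀ {t} → suc (suc t) ≢ n → profile n a b (suc t) ≡ a
  profile-inner {t} 2+t≢n = cong (if_then b else a) (dec-false (suc (suc t) ≟ n) 2+t≢n)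

  profile-last : ∀ {t} → suc (suc t) ≡ n → profile n a b (suc t) ≡ b
  profile-last {t} 2+t≡n = cong (if_then b else a) (dec-true (suc (suc t) ≟ n) 2+t≡n)

  profile-elim : ∀ (P : ℕ → Set) → P a → P b → ∀ t → P (profile n a b t)
  profile-elim P Pa Pb zero    = Pb
  profile-elim P Pa Pb (suc t) with does (suc (suc t) ≟ n)
  ... | true  = Pb
  ... | false = Pa

∑-profile : ∀ n a b → (∑[ t < 2 + n ] suc (profile (2 + n) a b t)) ≡ suc b + (n * suc a + suc b)
∑-profile n a b = cong (suc b +_) (begin
  (∑[ t < suc n ] h (suc t))          ≡⟨ ∑-last n (h ∘ suc) ⟩
  (∑[ t < n ] h (suc t)) + h (suc n)  ≡⟨ cong₂ _+_ (∑-const-< n inner) (cong suc (profile-last {a = a} {t = n} refl)) ⟩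
  n * suc a + suc b                   ∎)
  where
  open ≡-Reasoning
  h : ℕ → ℕ
  h t = suc (profile (2 + n) a b t)
  inner : ∀ t → t < n → h (suc t) ≡ suc a
  inner t t<n = cong suc (profile-inner (<⇒≢ (s<s (s<s t<n))))

weight-layerwise : ∀ m n G → weight m n (suc ∘ layerwise G) ≡ m * (∑[ t < n ] suc (G t))
weight-layerwise m n G = trans (sum-vertices m n (λ _ t → suc (G t))) (∑-const m _)

-- a and b are the values of f − 1 on inner and on end layers; the last three
-- fields are k ≤ 1 + g(N[v]) for the three kinds of vertex.
record Admissible (k a b : ℕ) : Set where
  field
    a≤k         : a ≤ k
    b≤k         : b ≤ k
    end-layer   : k ≤ suc (b * 3 + a)
    inner-layer : k ≤ suc (a * 4 + a)
    next-to-end : k ≤ suc (a * 4 + b)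

module _ {k a b : ℕ} (adm : Admissible k a b) (n′ : ℕ) where
  open Admissible adm

  private
    n : ℕ
    n = suc (suc (suc (suc n′)))

    G : ℕ → ℕ
    G = profile n a b

    G-inner : ∀ {t} → suc (suc t) ≢ n → G (suc t) ≡ a
    G-inner = profile-inner {n} {a} {b}

    closed : ℕ → ℕ
    closed t = suc (G t + (G t + G t + pathNbrSum n G t))

    end-bound : ∀ t → G t ≡ b → a ≤ pathNbrSum n G t → k ≤ closed t
    end-bound t Gt≡b a≤P rewrite Gt≡b = begin
      k                                    ≤⟨ end-layer ⟩
      suc (b * 3 + a)                      ≡⟨ cong suc (solve (a ∷ b ∷ [])) ⟩
      suc (b + (b + b + a))                ≤⟨ s≤s (+-monoʳ-≤ b (+-monoʳ-≤ (b + b) a≤P)) ⟩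
      suc (b + (b + b + pathNbrSum n G t)) ∎
      where open ≤-Reasoning

    inner-bound : ∀ t {c} → G t ≡ a → k ≤ suc (a * 4 + c) → a + c ≤ pathNbrSum n G t → k ≤ closed t
    inner-bound t {c} Gt≡a k≤ a+c≤P rewrite Gt≡a = begin
      k                                    ≤⟨ k≤ ⟩
      suc (a * 4 + c)                      ≡⟨ cong suc (solve (a ∷ c ∷ [])) ⟩
      suc (a + (a + a + (a + c)))          ≤⟨ s≤s (+-monoʳ-≤ a (+-monoʳ-≤ (a + a) a+c≤P)) ⟩
      suc (a + (a + a + pathNbrSum n G t)) ∎
      where open ≤-Reasoning

  profile-closedNbhd : ∀ t → t < n → k ≤ closed t
  profile-closedNbhd zero _ = end-bound 0 refl
    (subst (_≤ pathNbrSum n G 0) (G-inner {0} (λ ())) (pathNbrSum-≥-suc n G 0 (s≤s (s≤s z≤n))))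
  profile-closedNbhd (suc t) 1+t<n with suc (suc t) ≟ n
  profile-closedNbhd (suc zero) _ | yes ()
  profile-closedNbhd (suc (suc t)) 2+t<n | yes 3+t≡n = end-bound (suc (suc t)) (profile-last {n} {a} {b} 3+t≡n)
    (subst (_≤ pathNbrSum n G (suc (suc t))) (G-inner (λ 2+t≡n → 1+n≢n (trans 3+t≡n (sym 2+t≡n))))
      (pathNbrSum-≥-pred n G (suc t) (<-trans (n<1+n (suc t)) 2+t<n)))
  profile-closedNbhd (suc zero) _ | no 3≢n = inner-bound 1 (G-inner 3≢n) next-to-end
    (subst (_≤ pathNbrSum n G 1) (trans (cong (b +_) (G-inner {1} (λ ()))) (+-comm b a))
      (pathNbrSum-≥-both n G 0 (s≤s (s≤s (s≤s z≤n)))))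
  profile-closedNbhd (suc (suc t)) 2+t<n | no 3+t≢n = inner-bound (suc (suc t)) (G-inner 3+t≢n)
    (profile-elim {n} {a} {b} (λ c → k ≤ suc (a * 4 + c)) inner-layer next-to-end (suc (suc (suc t))))
    (subst (λ x → x + G (suc (suc (suc t))) ≤ pathNbrSum n G (suc (suc t))) (G-inner {t} (<⇒≢ 2+t<n))
      (pathNbrSum-≥-both n G (suc t) (≤∧≢⇒< 2+t<n 3+t≢n)))

  profile-isKRDF : ∀ {m} → 3 ≤ m → IsKRDF k m (4 + n′) (suc ∘ layerwise (profile (4 + n′) a b))
  profile-isKRDF 3≤m = isKRDF-suc (layerwise G) (λ v → profile-elim {n} {a} {b} (_≤ k) a≤k b≤k (toℕ (proj₂ v)))
    λ (i , j) → ≤-trans (profile-closedNbhd (toℕ j) (toℕ<n j))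
                        (s≤s (+-monoʳ-≤ (G (toℕ j)) (layerwise-weightOn-N≥ 3≤m G i j)))

weight-profile : ∀ m n a b →
  weight m (2 + n) (suc ∘ layerwise (profile (2 + n) a b)) ≡ m * n * suc a + 2 * m * suc b
weight-profile m n a b = begin
  weight m (2 + n) (suc ∘ layerwise (profile (2 + n) a b)) ≡⟨ weight-layerwise m (2 + n) (profile (2 + n) a b) ⟩
  m * (∑[ t < 2 + n ] suc (profile (2 + n) a b t))         ≡⟨ cong (m *_) (∑-profile n a b) ⟩
  m * (suc b + (n * suc a + suc b))                        ≡⟨ solve (m ∷ n ∷ a ∷ b ∷ []) ⟩
  m * n * suc a + 2 * m * suc b                            ∎
  where open ≡-Reasoning

m+d≤[1+m]*n : ∀ m {d n} .{{_ : NonZero n}} → d ≤ n → m + d ≤ suc m * n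
m+d≤[1+m]*n m {d} {n} d≤n = begin
  m + d      ≤⟨ +-mono-≤ (m≤m*n m n) d≤n ⟩
  m * n + n  ≡⟨ +-comm (m * n) n ⟩
  suc m * n  ∎
  where open ≤-Reasoning

admissible-of-bounds : ∀ {k A B} → 1 ≤ k →
  k + 4 ≤ A * 5 → A * 5 < k + 4 + 5 → k + 3 ≤ A + B * 3 → B * 3 < k + 3 + 3 →
  Σ ℕ λ a → Σ ℕ λ b → A ≡ suc a × B ≡ suc b × Admissible k a b
admissible-of-bounds {suc k} {zero} _ ()
admissible-of-bounds {suc k} {suc a} {B} _ lo₅ hi₅ lo₃ hi₃ = a , map₂ (refl ,_) (choose-b B lo₃ hi₃)
  where
  open ≤-Reasoning

  k≤a*5 : k ≤ a * 5
  k≤a*5 = +-cancelˡ-≤ 5 k (a * 5) (begin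
    5 + k         ≡⟨ solve (k ∷ []) ⟩
    suc k + 4     ≤⟨ lo₅ ⟩
    5 + a * 5     ∎)

  a*5≤k+4 : a * 5 ≤ k + 4
  a*5≤k+4 = +-cancelˡ-≤ 5 (a * 5) (k + 4) (begin
    5 + a * 5     ≤⟨ s≤s⁻¹ hi₅ ⟩
    k + 4 + 5     ≡⟨ +-comm (k + 4) 5 ⟩
    5 + (k + 4)   ∎)

  a≤1+k : a ≤ suc k
  a≤1+k = *-cancelʳ-≤ a (suc k) 5 (≤-trans a*5≤k+4 (m+d≤[1+m]*n k (n≤1+n 4)))

  choose-b : ∀ B → suc k + 3 ≤ suc a + B * 3 → B * 3 < suc k + 3 + 3 →
    Σ ℕ λ b → B ≡ suc b × Admissible (suc k) a b
  choose-b zero lo₃ _ = contradiction lo₃ (<⇒≱ (begin-strict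
    suc a + 0        ≡⟨ +-identityʳ (suc a) ⟩
    suc a            ≤⟨ s≤s a≤1+k ⟩
    suc (suc k)      <⟨ n<1+n (suc (suc k)) ⟩
    3 + k            ≡⟨ +-comm 3 k ⟩
    k + 3            <⟨ n<1+n (k + 3) ⟩
    suc k + 3        ∎))
  choose-b (suc b) lo₃ hi₃ = b , refl , record
    { a≤k         = a≤1+k
    ; b≤k         = *-cancelʳ-≤ b (suc k) 3 (≤-trans b*3≤k+3 (m+d≤[1+m]*n k ≤-refl))
    ; end-layer   = s≤s k≤b*3+a
    ; inner-layer = s≤s (≤-trans k≤a*5 (≤-reflexive (solve (a ∷ []))))
    ; next-to-end = s≤s (*-cancelʳ-≤ k (a * 4 + b) 3 (begin
        k * 3                          ≡⟨ solve (k ∷ []) ⟩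
        k + (k + k)                    ≤⟨ +-mono-≤ k≤b*3+a (+-mono-≤ k≤a*5 k≤a*5) ⟩
        b * 3 + a + (a * 5 + a * 5)     ≤⟨ m≤m+n _ a ⟩
        b * 3 + a + (a * 5 + a * 5) + a ≡⟨ solve (a ∷ b ∷ []) ⟩
        (a * 4 + b) * 3                ∎))
    }
    where
    k≤b*3+a : k ≤ b * 3 + a
    k≤b*3+a = +-cancelˡ-≤ 4 k (b * 3 + a) (begin
      4 + k             ≡⟨ solve (k ∷ []) ⟩
      suc k + 3         ≤⟨ lo₃ ⟩
      suc a + suc b * 3 ≡⟨ solve (a ∷ b ∷ []) ⟩
      4 + (b * 3 + a)   ∎)

    b*3≤k+3 : b * 3 ≤ k + 3
    b*3≤k+3 = +-cancelˡ-≤ 3 (b * 3) (k + 3) (begin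
      3 + b * 3         ≤⟨ s≤s⁻¹ hi₃ ⟩
      k + 3 + 3         ≡⟨ +-comm (k + 3) 3 ⟩
      3 + (k + 3)       ∎)

ceilings-admissible : ∀ {k} → 1 ≤ k →
  Σ ℕ λ a → Σ ℕ λ b → ⌈ k + 4 / 5 ⌉ ≡ suc a × ⌈ k + 3 ∸ ⌈ k + 4 / 5 ⌉ / 3 ⌉ ≡ suc b × Admissible k a b
ceilings-admissible {k} 1≤k = admissible-of-bounds 1≤k
  (m≤⌈m/n⌉*n (k + 4) 5) (⌈m/n⌉*n<m+n (k + 4) 5)
  (≤-trans (m≤n+m∸n (k + 3) A) (+-monoʳ-≤ A (m≤⌈m/n⌉*n (k + 3 ∸ A) 3)))
  (<-≤-trans (⌈m/n⌉*n<m+n (k + 3 ∸ A) 3) (+-monoˡ-≤ 3 (m∸n≤m (k + 3) A)))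
  where
  A = ⌈ k + 4 / 5 ⌉

theorem7 : (k m n : ℕ) → 1 ≤ k → 3 ≤ m → 4 ≤ n →
    Σ (Vertex m n → ℕ) λ f →
    IsKRDF k m n f ×
    weight m n f ≤ m * (n ∸ 2) * ⌈ k + 4 / 5 ⌉ + 2 * m * ⌈ k + 3 ∸ ⌈ k + 4 / 5 ⌉ / 3 ⌉
theorem7 k m n 1≤k 3≤m 4≤n with m≤n⇒∃[o]m+o≡n 4≤n | ceilings-admissible 1≤k
... | n′ , refl | a , b , A≡1+a , B≡1+b , adm =
  f , profile-isKRDF adm n′ 3≤m , ≤-reflexive (begin
    weight m (4 + n′) f                ≡⟨ weight-profile m (2 + n′) a b ⟩
    m * (2 + n′) * suc a + 2 * m * suc b ≡⟨ cong₂ (λ A B → m * (2 + n′) * A + 2 * m * B) A≡1+a B≡1+b ⟨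
    m * (2 + n′) * ⌈ k + 4 / 5 ⌉ + 2 * m * ⌈ k + 3 ∸ ⌈ k + 4 / 5 ⌉ / 3 ⌉ ∎)
  where
  open ≡-Reasoning
  f : Vertex m (4 + n′) → ℕ
  f = suc ∘ layerwise (profile (4 + n′) a b)
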